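{- Let $G$ be a finite non-cyclic group and let $v\neq e$ be a dominating vertex of $\mathcal{G}_e(G)$. Then there exists a prime $p$ dividing $\mathrm{o}(v)$ such that $G$ has a unique subgroup of order $p$.
   Context: For a finite group $G$ with identity $e$, the enhanced power graph $\mathcal{G}_e(G)$ is the simple graph with vertex set $G$ in which two distinct vertices $u,v$ are adjacent iff there exists $w\in G$ such that both $u$ and $v$ are powers of $w$. A dominating vertex is a vertex adjacent to every other vertex. $\mathrm{o}(v)$ is the order of $v$. -}

module Defs where

open import Data.Nat using (ℕ; zero; suc; _≤_; _<_)
open import Data.Fin using (Fin)
open import Data.Fin.Subset using (Subset; _∈_; ∣_∣)
open import Data.Product using (Σ; _×_; ∃; ∃-syntax)
open import Data.Nat.Primality using (Prime)
open import Data.Nat.Divisibility using (_∣_)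
open import Relation.Nullary using (¬_)
open import Relation.Binary.PropositionalEquality using (_≡_; _≢_)
open import Algebra.Core using (Op₁; Op₂)

module GroupDefs {n : ℕ} (_∙_ : Op₂ (Fin n)) (ε : Fin n) (_⁻¹ : Op₁ (Fin n)) where

  pow : Fin n → ℕ → Fin n
  pow g zero    = ε
  pow g (suc k) = g ∙ pow g k

  IsPowerOf : Fin n → Fin n → Set
  IsPowerOf u w = ∃[ k ] u ≡ pow w k

  Adjacent : Fin n → Fin n → Set
  Adjacent u v = u ≢ v × (∃[ w ] (IsPowerOf u w × IsPowerOf v w))

  Dominating : Fin n → Set
  Dominating v = ∀ u → u ≢ v → Adjacent u v

  Cyclic : Set
  Cyclic = ∃[ g ] (∀ x → IsPowerOf x g)

  IsOrder : Fin n → ℕ → Set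
  IsOrder v m = 0 < m × pow v m ≡ ε × (∀ k → 0 < k → pow v k ≡ ε → m ≤ k)

  IsSubgroup : Subset n → Set
  IsSubgroup H = ε ∈ H × (∀ x y → x ∈ H → y ∈ H → (x ∙ y) ∈ H) × (∀ x → x ∈ H → (x ⁻¹) ∈ H)

  UniqueSubgroupOfOrder : ℕ → Set
  UniqueSubgroupOfOrder p =
    ∃[ H ] (IsSubgroup H × ∣ H ∣ ≡ p × (∀ K → IsSubgroup K → ∣ K ∣ ≡ p → K ≡ H))

module Submission where

-- Let v ≠ e be a dominating vertex of the enhanced power graph of a finite
-- group G, and let m be its order.  We prove more than is asked: for EVERY
-- divisor d of m the group G has a unique subgroup of order d; the theorem
-- then follows by choosing a prime divisor of m > 1.
--
-- Write m = q·d and w = v^q, an element of order d, and H = ⟨w⟩ (|H| = d).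
--   * If K is a subgroup with |K| = d, then x^d = e for every x ∈ K, because
--     the ⟨x⟩-orbits partition K (a Lagrange-type counting argument).
--   * If x^d = e, then x and v are powers of a common g (domination), and in
--     the cyclic group ⟨g⟩ every solution of x^d = e lies in ⟨w⟩.
-- Hence K ⊆ H, and K = H since both have d elements.

open import Defs
open import Data.Nat using (ℕ)
open import Data.Fin using (Fin)
open import Data.Product using (_×_; ∃-syntax)
open import Data.Nat.Primality using (Prime)
open import Data.Nat.Divisibility using (_∣_)
open import Relation.Nullary using (¬_)
open import Relation.Binary.PropositionalEquality using (_≡_; _≢_)
open import Algebra.Core using (Op₁; Op₂)
open import Algebra.Structures using (IsGroup)

open import Data.Nat
  using (zero; suc; _+_; _*_; _∸_; _<_; _≤_; s≤s; s≤s⁻¹; z<s; NonZero; >-nonZero; >-nonZero⁻¹; _%_; _/_)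
open import Data.Nat.Properties
open import Data.Nat.DivMod using (m≡m%n+[m/n]*n; m%n<n)
open import Data.Nat.Divisibility
  using (divides; _∣0; ∣-refl; m∣m*n; ∣m∣n⇒∣m+n; m%n≡0⇒n∣m; *-cancelʳ-∣)
open import Data.Nat.Primality.Factorisation using (factorise)
import Data.List as List
open import Data.List.Relation.Unary.All using (_∷_)
open import Data.Fin using (zero; suc; toℕ)
import Data.Fin.Properties as Fin
open import Data.Fin.Subset
  using (Subset; inside; outside; _∈_; _∉_; _⊆_; ∣_∣; _─_; _∪_; ⁅_⁆; ⊥)
open import Data.Fin.Subset.Properties
  using ( _∈?_; ⊆-antisym; p⊂q⇒∣p∣<∣q∣; drop-∷-⊆; ∪-identityˡ; x∈p∪q⁺; x∈p∪q⁻
        ; x∈⁅x⁆; x∈⁅y⁆⇒x≡y; ∉⊥; ∣⊥∣≡0; nonempty?; Empty-unique; p─q⊆p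
        ; x∈p∧x∉q⇒x∈p─q)
open import Data.Vec using ([]; _∷_; here; there)
open import Data.Product using (_,_; proj₁; proj₂)
open import Data.Sum using (inj₁; inj₂)
open import Data.Empty using (⊥-elim)
open import Relation.Nullary using (yes; no; Dec)
open import Relation.Binary.Definitions using (tri<; tri≈; tri>)
open import Relation.Binary.PropositionalEquality
  using (refl; sym; trans; cong; subst; module ≡-Reasoning)
open import Algebra.Bundles using (Group)
import Algebra.Properties.Group as GroupProperties

private
  variable
    n : ℕ

⊆∧∣≡∣⇒≡ : {p q : Subset n} → p ⊆ q → ∣ p ∣ ≡ ∣ q ∣ → p ≡ q
⊆∧∣≡∣⇒≡ {p = p} {q} p⊆q ∣p∣≡∣q∣ = ⊆-antisym p⊆q q⊆p
  where
  q⊆p : q ⊆ p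
  q⊆p {x} x∈q with x ∈? p
  ... | yes x∈p = x∈p
  ... | no  x∉p = ⊥-elim (<⇒≢ (p⊂q⇒∣p∣<∣q∣ (p⊆q , x , x∈q , x∉p)) ∣p∣≡∣q∣)

x∈p─q⇒x∉q : ∀ {x : Fin n} (p q : Subset n) → x ∈ p ─ q → x ∉ q
x∈p─q⇒x∉q (inside  ∷ p) (outside ∷ q) here      ()
x∈p─q⇒x∉q (_       ∷ p) (_       ∷ q) (there h) (there h′) = x∈p─q⇒x∉q p q h h′

∣p─q∣+∣q∣≡∣p∣ : (p q : Subset n) → q ⊆ p → ∣ p ─ q ∣ + ∣ q ∣ ≡ ∣ p ∣
∣p─q∣+∣q∣≡∣p∣ []            []            _   = refl
∣p─q∣+∣q∣≡∣p∣ (inside  ∷ p) (inside  ∷ q) q⊆p =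
  trans (+-suc _ _) (cong suc (∣p─q∣+∣q∣≡∣p∣ p q (drop-∷-⊆ q⊆p)))
∣p─q∣+∣q∣≡∣p∣ (inside  ∷ p) (outside ∷ q) q⊆p = cong suc (∣p─q∣+∣q∣≡∣p∣ p q (drop-∷-⊆ q⊆p))
∣p─q∣+∣q∣≡∣p∣ (outside ∷ p) (inside  ∷ q) q⊆p with q⊆p here
... | ()
∣p─q∣+∣q∣≡∣p∣ (outside ∷ p) (outside ∷ q) q⊆p = ∣p─q∣+∣q∣≡∣p∣ p q (drop-∷-⊆ q⊆p)

∣⁅x⁆∪p∣≡1+∣p∣ : (x : Fin n) (p : Subset n) → x ∉ p → ∣ ⁅ x ⁆ ∪ p ∣ ≡ suc ∣ p ∣
∣⁅x⁆∪p∣≡1+∣p∣ zero    (inside  ∷ p) x∉p = ⊥-elim (x∉p here)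
∣⁅x⁆∪p∣≡1+∣p∣ zero    (outside ∷ p) x∉p = cong (λ s → suc ∣ s ∣) (∪-identityˡ p)
∣⁅x⁆∪p∣≡1+∣p∣ (suc x) (inside  ∷ p) x∉p = cong suc (∣⁅x⁆∪p∣≡1+∣p∣ x p (λ h → x∉p (there h)))
∣⁅x⁆∪p∣≡1+∣p∣ (suc x) (outside ∷ p) x∉p = ∣⁅x⁆∪p∣≡1+∣p∣ x p (λ h → x∉p (there h))

image : ℕ → (ℕ → Fin n) → Subset n
image zero    f = ⊥
image (suc k) f = ⁅ f k ⁆ ∪ image k f

∈-image : ∀ k (f : ℕ → Fin n) {i} → i < k → f i ∈ image k f
∈-image (suc k) f {i} (s≤s i≤k) with i ≟ k
... | yes refl = x∈p∪q⁺ (inj₁ (x∈⁅x⁆ (f k)))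
... | no  i≢k  = x∈p∪q⁺ {p = ⁅ f k ⁆} (inj₂ (∈-image k f (≤∧≢⇒< i≤k i≢k)))

∈-image⁻ : ∀ k (f : ℕ → Fin n) {x} → x ∈ image k f → ∃[ i ] (i < k × x ≡ f i)
∈-image⁻ zero    f x∈ = ⊥-elim (∉⊥ x∈)
∈-image⁻ (suc k) f x∈ with x∈p∪q⁻ ⁅ f k ⁆ (image k f) x∈
... | inj₁ x∈⁅fk⁆ = k , ≤-refl , x∈⁅y⁆⇒x≡y (f k) x∈⁅fk⁆
... | inj₂ x∈img with ∈-image⁻ k f x∈img
...   | i , i<k , x≡fi = i , m≤n⇒m≤1+n i<k , x≡fi

InjectiveBelow : ℕ → (ℕ → Fin n) → Set
InjectiveBelow k f = ∀ i j → i < k → j < k → f i ≡ f j → i ≡ j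

∣image∣ : ∀ k (f : ℕ → Fin n) → InjectiveBelow k f → ∣ image k f ∣ ≡ k
∣image∣ {n} zero    f inj = ∣⊥∣≡0 n
∣image∣     (suc k) f inj =
  trans (∣⁅x⁆∪p∣≡1+∣p∣ (f k) (image k f) fk∉) (cong suc (∣image∣ k f inj′))
  where
  inj′ : InjectiveBelow k f
  inj′ i j i<k j<k = inj i j (m≤n⇒m≤1+n i<k) (m≤n⇒m≤1+n j<k)
  fk∉ : f k ∉ image k f
  fk∉ fk∈ with ∈-image⁻ k f fk∈
  ... | i , i<k , fk≡fi = <-irrefl (inj i k (m≤n⇒m≤1+n i<k) ≤-refl (sym fk≡fi)) i<k

least : (P : ℕ → Set) → (∀ k → Dec (P k)) → ∀ {t} → P t →
        ∃[ k ] (P k × (∀ j → j < k → ¬ P j))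
least P P? {t} Pt = search 0 t (λ _ ()) Pt
  where
  search : ∀ i d → (∀ j → j < i → ¬ P j) → P (i + d) →
           ∃[ k ] (P k × (∀ j → j < k → ¬ P j))
  search i d below Pi+d with P? i
  ... | yes Pi = i , Pi , below
  search i zero    below Pi+d | no ¬Pi = ⊥-elim (¬Pi (subst P (+-identityʳ i) Pi+d))
  search i (suc d) below Pi+d | no ¬Pi =
    search (suc i) d below′ (subst P (+-suc i d) Pi+d)
    where
    below′ : ∀ j → j < suc i → ¬ P j
    below′ j j<1+i with m≤n⇒m<n∨m≡n (s≤s⁻¹ j<1+i)
    ... | inj₁ j<i  = below j j<i
    ... | inj₂ refl = ¬Pi

prime-divisor : ∀ {m} → 1 < m → ∃[ p ] (Prime p × p ∣ m)
prime-divisor {m} 1<m with factorise m {{>-nonZero (<-trans z<s 1<m)}}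
... | record { factors = List.[] ; isFactorisation = m≡1 } = ⊥-elim (<⇒≢ 1<m (sym m≡1))
... | record { factors = p List.∷ _ ; isFactorisation = m≡p*ps ; factorsPrime = p-prime ∷ _ } =
  p , p-prime , subst (p ∣_) (sym m≡p*ps) (m∣m*n _)

module FiniteGroup {n : ℕ} (_∙_ : Op₂ (Fin n)) (ε : Fin n) (_⁻¹ : Op₁ (Fin n))
                   (isGroup : IsGroup _≡_ _∙_ ε _⁻¹) where

  open IsGroup isGroup using (assoc; identityˡ; identityʳ)
  open GroupDefs _∙_ ε _⁻¹

  G : Group _ _
  G = record { isGroup = isGroup }

  open GroupProperties G using (∙-cancelʳ; inverseʳ-unique)

  pow-1 : ∀ g → pow g 1 ≡ g
  pow-1 = identityʳ

  pow-+ : ∀ g a b → pow g (a + b) ≡ pow g a ∙ pow g b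
  pow-+ g zero    b = sym (identityˡ _)
  pow-+ g (suc a) b = trans (cong (g ∙_) (pow-+ g a b)) (sym (assoc g _ _))

  pow-pow : ∀ g a b → pow (pow g b) a ≡ pow g (a * b)
  pow-pow g zero    b = refl
  pow-pow g (suc a) b = trans (cong (pow g b ∙_) (pow-pow g a b)) (sym (pow-+ g b (a * b)))

  pow-ε : ∀ k → pow ε k ≡ ε
  pow-ε zero    = refl
  pow-ε (suc k) = trans (identityˡ _) (pow-ε k)

  pow-comm : ∀ g a b → pow (pow g a) b ≡ pow (pow g b) a
  pow-comm g a b = begin
    pow (pow g a) b ≡⟨ pow-pow g b a ⟩
    pow g (b * a)   ≡⟨ cong (pow g) (*-comm b a) ⟩
    pow g (a * b)   ≡⟨ sym (pow-pow g a b) ⟩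
    pow (pow g b) a ∎
    where open ≡-Reasoning

  pow-multiple : ∀ {g N j} → pow g N ≡ ε → N ∣ j → pow g j ≡ ε
  pow-multiple {g} {N} gᴺ≡ε (divides c refl) = begin
    pow g (c * N)   ≡⟨ sym (pow-pow g c N) ⟩
    pow (pow g N) c ≡⟨ cong (λ h → pow h c) gᴺ≡ε ⟩
    pow ε c         ≡⟨ pow-ε c ⟩
    ε               ∎
    where open ≡-Reasoning

  pow-mod : ∀ g N .{{_ : NonZero N}} → pow g N ≡ ε → ∀ j → pow g j ≡ pow g (j % N)
  pow-mod g N gᴺ≡ε j = begin
    pow g j                             ≡⟨ cong (pow g) (m≡m%n+[m/n]*n j N) ⟩
    pow g (j % N + (j / N) * N)         ≡⟨ pow-+ g (j % N) _ ⟩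
    pow g (j % N) ∙ pow g ((j / N) * N) ≡⟨ cong (pow g (j % N) ∙_) gᴺ⁽ʲᐟᴺ⁾≡ε ⟩
    pow g (j % N) ∙ ε                   ≡⟨ identityʳ _ ⟩
    pow g (j % N)                       ∎
    where
    open ≡-Reasoning
    gᴺ⁽ʲᐟᴺ⁾≡ε : pow g ((j / N) * N) ≡ ε
    gᴺ⁽ʲᐟᴺ⁾≡ε = pow-multiple gᴺ≡ε (divides (j / N) refl)

  pow-cancel : ∀ g {i j} → i ≤ j → pow g i ≡ pow g j → pow g (j ∸ i) ≡ ε
  pow-cancel g {i} {j} i≤j gⁱ≡gʲ = ∙-cancelʳ (pow g i) _ _ (begin
    pow g (j ∸ i) ∙ pow g i ≡⟨ sym (pow-+ g (j ∸ i) i) ⟩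
    pow g (j ∸ i + i)       ≡⟨ cong (pow g) (m∸n+n≡m i≤j) ⟩
    pow g j                 ≡⟨ sym gⁱ≡gʲ ⟩
    pow g i                 ≡⟨ sym (identityˡ _) ⟩
    ε ∙ pow g i             ∎)
    where open ≡-Reasoning

  order-∣ : ∀ {g N} → IsOrder g N → ∀ {j} → pow g j ≡ ε → N ∣ j
  order-∣ {g} {N@(suc _)} (_ , gᴺ≡ε , minimal) {j} gʲ≡ε with j % N ≟ 0
  ... | yes r≡0 = m%n≡0⇒n∣m j N r≡0
  ... | no  r≢0 = ⊥-elim (<⇒≱ (m%n<n j N)
                    (minimal _ (n≢0⇒n>0 r≢0) (trans (sym (pow-mod g N gᴺ≡ε j)) gʲ≡ε)))

  order-injective : ∀ {g N} → IsOrder g N → InjectiveBelow N (pow g)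
  order-injective {g} (_ , _ , minimal) i j i<N j<N gⁱ≡gʲ with <-cmp i j
  ... | tri≈ _ i≡j _ = i≡j
  ... | tri< i<j _ _ = ⊥-elim (<⇒≱ (≤-<-trans (m∸n≤m j i) j<N)
                         (minimal _ (m<n⇒0<n∸m i<j) (pow-cancel g (<⇒≤ i<j) gⁱ≡gʲ)))
  ... | tri> _ _ j<i = ⊥-elim (<⇒≱ (≤-<-trans (m∸n≤m i j) i<N)
                         (minimal _ (m<n⇒0<n∸m j<i) (pow-cancel g (<⇒≤ j<i) (sym gⁱ≡gʲ))))

  -- Every element has an order: by pigeonhole two of g^0, …, g^n coincide,
  -- so some positive power is e, and we take the least one.
  order-exists : ∀ g → ∃[ N ] IsOrder g N
  order-exists g with Fin.pigeonhole (n<1+n n) (λ i → pow g (toℕ i))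
  ... | i , j , i<j , gⁱ≡gʲ
    with least Kills kills? (m<n⇒0<n∸m i<j , pow-cancel g (<⇒≤ i<j) gⁱ≡gʲ)
    where
    Kills : ℕ → Set
    Kills k = 0 < k × pow g k ≡ ε
    kills? : ∀ k → Dec (Kills k)
    kills? zero    = no λ ()
    kills? (suc k) with pow g (suc k) Fin.≟ ε
    ... | yes gᵏ≡ε = yes (z<s , gᵏ≡ε)
    ... | no  gᵏ≢ε = no λ kills → gᵏ≢ε (proj₂ kills)
  ... | N , (N>0 , gᴺ≡ε) , below =
    N , N>0 , gᴺ≡ε , λ k k>0 gᵏ≡ε → ≮⇒≥ λ k<N → below k k<N (k>0 , gᵏ≡ε)

  order>1 : ∀ {g N} → IsOrder g N → g ≢ ε → 1 < N
  order>1 {g} {suc zero}    (_ , g¹≡ε , _) g≢ε = ⊥-elim (g≢ε (trans (sym (pow-1 g)) g¹≡ε))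
  order>1 {N = suc (suc _)} _              _   = s≤s z<s

  order-pow : ∀ {g} s {t} → IsOrder g (s * t) → IsOrder (pow g s) t
  order-pow {g} s {t} (st>0 , gˢᵗ≡ε , minimal) = t>0 , gˢ^t≡ε , minimal′
    where
    instance
      st≢0 : NonZero (s * t)
      st≢0 = >-nonZero st>0
      s≢0 : NonZero s
      s≢0 = m*n≢0⇒m≢0 s
    t>0 : 0 < t
    t>0 = >-nonZero⁻¹ t {{m*n≢0⇒n≢0 s}}
    gˢ^t≡ε : pow (pow g s) t ≡ ε
    gˢ^t≡ε = trans (pow-pow g t s) (trans (cong (pow g) (*-comm t s)) gˢᵗ≡ε)
    minimal′ : ∀ k → 0 < k → pow (pow g s) k ≡ ε → t ≤ k
    minimal′ k k>0 gˢ^k≡ε = *-cancelˡ-≤ s (minimal (s * k) sk>0 gˢᵏ≡ε)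
      where
      sk>0 : 0 < s * k
      sk>0 = >-nonZero⁻¹ (s * k) {{m*n≢0 s k {{s≢0}} {{>-nonZero k>0}}}}
      gˢᵏ≡ε : pow g (s * k) ≡ ε
      gˢᵏ≡ε = trans (cong (pow g) (*-comm s k)) (trans (sym (pow-pow g k s)) gˢ^k≡ε)

  powers : Fin n → ℕ → Subset n
  powers g N = image N (pow g)

  ∈-powers : ∀ {g N} → IsOrder g N → ∀ j → pow g j ∈ powers g N
  ∈-powers {g} {N@(suc _)} (_ , gᴺ≡ε , _) j =
    subst (_∈ powers g N) (sym (pow-mod g N gᴺ≡ε j)) (∈-image N (pow g) (m%n<n j N))

  ∣powers∣ : ∀ {g N} → IsOrder g N → ∣ powers g N ∣ ≡ N
  ∣powers∣ {g} {N} ord = ∣image∣ N (pow g) (order-injective ord)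

  powers-subgroup : ∀ {g N} → IsOrder g N → IsSubgroup (powers g N)
  powers-subgroup {g} {N} ord@(_ , gᴺ≡ε , _) = ∈-powers ord 0 , closed , inverses
    where
    closed : ∀ x y → x ∈ powers g N → y ∈ powers g N → (x ∙ y) ∈ powers g N
    closed x y x∈ y∈ with ∈-image⁻ N (pow g) x∈ | ∈-image⁻ N (pow g) y∈
    ... | i , _ , refl | j , _ , refl = subst (_∈ powers g N) (pow-+ g i j) (∈-powers ord (i + j))
    inverses : ∀ x → x ∈ powers g N → (x ⁻¹) ∈ powers g N
    inverses x x∈ with ∈-image⁻ N (pow g) x∈
    ... | i , i<N , refl = subst (_∈ powers g N) (inverseʳ-unique (pow g i) _ gⁱgᴺ⁻ⁱ≡ε) (∈-powers ord (N ∸ i))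
      where
      gⁱgᴺ⁻ⁱ≡ε : pow g i ∙ pow g (N ∸ i) ≡ ε
      gⁱgᴺ⁻ⁱ≡ε = trans (sym (pow-+ g i (N ∸ i))) (trans (cong (pow g) (m+[n∸m]≡n (<⇒≤ i<N))) gᴺ≡ε)

  -- Orbit counting: if x has order N and S is closed under y ↦ x ∙ y, then
  -- S splits into orbits { x^i ∙ y | i < N } of size N, so N divides ∣ S ∣.

  module Orbits {x : Fin n} {N : ℕ} (ord : IsOrder x N) where

    N>0 : 0 < N
    N>0 = proj₁ ord

    xᴺ≡ε : pow x N ≡ ε
    xᴺ≡ε = proj₁ (proj₂ ord)

    instance
      N≢0 : NonZero N
      N≢0 = >-nonZero N>0

    LeftInvariant : Subset n → Set
    LeftInvariant S = ∀ y → y ∈ S → (x ∙ y) ∈ S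

    orbit : Fin n → Subset n
    orbit y = image N (λ i → pow x i ∙ y)

    ∈-orbit : ∀ y j → pow x j ∙ y ∈ orbit y
    ∈-orbit y j = subst (_∈ orbit y) (cong (_∙ y) (sym (pow-mod x N xᴺ≡ε j)))
                    (∈-image N _ (m%n<n j N))

    ∣orbit∣ : ∀ y → ∣ orbit y ∣ ≡ N
    ∣orbit∣ y = ∣image∣ N _ λ i j i<N j<N eq → order-injective ord i j i<N j<N (∙-cancelʳ y _ _ eq)

    orbit⊆ : ∀ {S y} → LeftInvariant S → y ∈ S → orbit y ⊆ S
    orbit⊆ {S} {y} inv y∈S z∈ with ∈-image⁻ N _ z∈
    ... | i , _ , refl = powers∈ i
      where
      powers∈ : ∀ i → pow x i ∙ y ∈ S
      powers∈ zero    = subst (_∈ S) (sym (identityˡ y)) y∈S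
      powers∈ (suc i) = subst (_∈ S) (sym (assoc x (pow x i) y)) (inv _ (powers∈ i))

    -- Multiplying by x maps the complement of an orbit into itself, since
    -- x ∙ z = x^i ∙ y forces z = x^(N - 1 + i) ∙ y.
    ─orbit-invariant : ∀ {S} y → LeftInvariant S → LeftInvariant (S ─ orbit y)
    ─orbit-invariant {S} y inv z z∈ =
      x∈p∧x∉q⇒x∈p─q (inv z (p─q⊆p S (orbit y) z∈)) xz∉
      where
      xz∉ : (x ∙ z) ∉ orbit y
      xz∉ xz∈ with ∈-image⁻ N _ xz∈
      ... | i , _ , xz≡xⁱy =
        x∈p─q⇒x∉q S (orbit y) z∈ (subst (_∈ orbit y) (sym z≡) (∈-orbit y (N ∸ 1 + i)))
        where
        xᴺ⁻¹x≡ε : pow x (N ∸ 1) ∙ x ≡ ε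
        xᴺ⁻¹x≡ε = trans (cong (pow x (N ∸ 1) ∙_) (sym (pow-1 x)))
                   (trans (sym (pow-+ x (N ∸ 1) 1)) (trans (cong (pow x) (m∸n+n≡m N>0)) xᴺ≡ε))
        z≡ : z ≡ pow x (N ∸ 1 + i) ∙ y
        z≡ = begin
          z                             ≡⟨ sym (identityˡ z) ⟩
          ε ∙ z                         ≡⟨ cong (_∙ z) (sym xᴺ⁻¹x≡ε) ⟩
          (pow x (N ∸ 1) ∙ x) ∙ z       ≡⟨ assoc _ _ _ ⟩
          pow x (N ∸ 1) ∙ (x ∙ z)       ≡⟨ cong (pow x (N ∸ 1) ∙_) xz≡xⁱy ⟩
          pow x (N ∸ 1) ∙ (pow x i ∙ y) ≡⟨ sym (assoc _ _ _) ⟩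
          (pow x (N ∸ 1) ∙ pow x i) ∙ y ≡⟨ cong (_∙ y) (sym (pow-+ x (N ∸ 1) i)) ⟩
          pow x (N ∸ 1 + i) ∙ y         ∎
          where open ≡-Reasoning

    -- By induction on an upper bound k for ∣ S ∣, removing one orbit at a time.
    order-∣-invariant : ∀ {S} → LeftInvariant S → N ∣ ∣ S ∣
    order-∣-invariant {S} = go ∣ S ∣ S ≤-refl
      where
      go : ∀ k S → ∣ S ∣ ≤ k → LeftInvariant S → N ∣ ∣ S ∣
      go k S ∣S∣≤k inv with nonempty? S
      ... | no  empty = subst (N ∣_) (sym (trans (cong ∣_∣ (Empty-unique empty)) (∣⊥∣≡0 n))) (N ∣0)
      ... | yes (y , y∈S) = subst (N ∣_) split (∣m∣n⇒∣m+n (rest k ∣S∣≤k) ∣-refl)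
        where
        split : ∣ S ─ orbit y ∣ + N ≡ ∣ S ∣
        split = trans (cong (∣ S ─ orbit y ∣ +_) (sym (∣orbit∣ y)))
                      (∣p─q∣+∣q∣≡∣p∣ S (orbit y) (orbit⊆ inv y∈S))
        rest : ∀ k → ∣ S ∣ ≤ k → N ∣ ∣ S ─ orbit y ∣
        rest zero    ∣S∣≤0 = ⊥-elim (<⇒≱ (≤-trans N>0 (subst (N ≤_) split (m≤n+m N _))) ∣S∣≤0)
        rest (suc k) ∣S∣≤k = go k (S ─ orbit y) smaller (─orbit-invariant y inv)
          where
          smaller : ∣ S ─ orbit y ∣ ≤ k
          smaller = s≤s⁻¹ (≤-trans (subst (∣ S ─ orbit y ∣ <_) split (m<m+n _ N>0)) ∣S∣≤k)

  pow-∣subgroup∣ : ∀ {K} → IsSubgroup K → ∀ {x} → x ∈ K → pow x ∣ K ∣ ≡ ε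
  pow-∣subgroup∣ {K} (_ , closed , _) {x} x∈K with order-exists x
  ... | N , ord@(_ , xᴺ≡ε , _) =
    pow-multiple xᴺ≡ε (Orbits.order-∣-invariant ord λ y y∈K → closed x y x∈K y∈K)

  unique-subgroup : ∀ {H d} → IsSubgroup H → ∣ H ∣ ≡ d → (∀ x → pow x d ≡ ε → x ∈ H) →
                    UniqueSubgroupOfOrder d
  unique-subgroup {H} {d} H≤G ∣H∣≡d torsion⊆H = H , H≤G , ∣H∣≡d , unique
    where
    unique : ∀ K → IsSubgroup K → ∣ K ∣ ≡ d → K ≡ H
    unique K K≤G ∣K∣≡d = ⊆∧∣≡∣⇒≡ K⊆H (trans ∣K∣≡d (sym ∣H∣≡d))
      where
      K⊆H : K ⊆ H
      K⊆H {x} x∈K = torsion⊆H x (subst (λ k → pow x k ≡ ε) ∣K∣≡d (pow-∣subgroup∣ K≤G x∈K))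

  -- Torsion of cyclic groups: if g has order r * d, every power of g solving
  -- y^d = e is a power of g^r (as (g^c)^d = e forces r * d ∣ c * d).
  torsion-of-cyclic : ∀ {g} r {d} → IsOrder g (r * d) → ∀ c →
                      pow (pow g c) d ≡ ε → IsPowerOf (pow g c) (pow g r)
  torsion-of-cyclic {g} r {d} ord c gᶜ^d≡ε
    with *-cancelʳ-∣ {r} {c} d {{d≢0}} (order-∣ ord gᶜᵈ≡ε)
    where
    d≢0 : NonZero d
    d≢0 = >-nonZero (proj₁ (order-pow r ord))
    gᶜᵈ≡ε : pow g (c * d) ≡ ε
    gᶜᵈ≡ε = trans (cong (pow g) (*-comm c d)) (trans (sym (pow-pow g d c)) gᶜ^d≡ε)
  ... | divides c′ refl = c′ , (begin
    pow g (c′ * r)   ≡⟨ cong (pow g) (*-comm c′ r) ⟩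
    pow g (r * c′)   ≡⟨ sym (pow-pow g r c′) ⟩
    pow (pow g c′) r ≡⟨ pow-comm g c′ r ⟩
    pow (pow g r) c′ ∎)
    where open ≡-Reasoning

  power-of-power : ∀ {u v g} → IsPowerOf u v → IsPowerOf v g → IsPowerOf u g
  power-of-power {g = g} (a , refl) (b , refl) = a * b , pow-pow g a b

  -- In the cyclic group generated by g, every solution of x^d = e is a power
  -- of any element w ∈ ⟨ g ⟩ of order d: with N = r * d the order of g (d ∣ N
  -- as w^N = e), both ⟨ w ⟩ and the solutions lie in ⟨ g^r ⟩, and ⟨ w ⟩ and
  -- ⟨ g^r ⟩ coincide because both have d elements.
  cyclic-torsion : ∀ {g w x d} → IsOrder w d → IsPowerOf w g → IsPowerOf x g →
                   pow x d ≡ ε → x ∈ powers w d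
  cyclic-torsion {g} {w} {x} {d} ordw (c , refl) (a , refl) xᵈ≡ε with order-exists g
  ... | N , ordg@(_ , gᴺ≡ε , _) with order-∣ ordw {N} wᴺ≡ε
    where
    wᴺ≡ε : pow (pow g c) N ≡ ε
    wᴺ≡ε = trans (pow-comm g c N) (trans (cong (λ h → pow h c) gᴺ≡ε) (pow-ε c))
  ...   | divides r refl = subst (x ∈_) (sym ⟨w⟩≡⟨h⟩) x∈⟨h⟩
    where
    h : Fin n
    h = pow g r
    ordh : IsOrder h d
    ordh = order-pow r ordg
    x∈⟨h⟩ : x ∈ powers h d
    x∈⟨h⟩ with torsion-of-cyclic r ordg a xᵈ≡ε
    ... | a′ , x≡hᵃ′ = subst (_∈ powers h d) (sym x≡hᵃ′) (∈-powers ordh a′)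
    ⟨w⟩⊆⟨h⟩ : powers w d ⊆ powers h d
    ⟨w⟩⊆⟨h⟩ y∈ with ∈-image⁻ d (pow w) y∈ | torsion-of-cyclic r ordg c (proj₁ (proj₂ ordw))
    ... | i , _ , refl | c′ , w≡hᶜ′ =
      subst (_∈ powers h d) (sym wⁱ≡hⁱᶜ′) (∈-powers ordh (i * c′))
      where
      wⁱ≡hⁱᶜ′ : pow w i ≡ pow h (i * c′)
      wⁱ≡hⁱᶜ′ = trans (cong (λ u → pow u i) w≡hᶜ′) (pow-pow h i c′)
    ⟨w⟩≡⟨h⟩ : powers w d ≡ powers h d
    ⟨w⟩≡⟨h⟩ = ⊆∧∣≡∣⇒≡ ⟨w⟩⊆⟨h⟩ (trans (∣powers∣ ordw) (sym (∣powers∣ ordh)))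

  -- If v is dominating and w is a power of v of order d, then every solution
  -- of x^d = e lies in ⟨ w ⟩: x and v are powers of a common element.
  dominating-torsion : ∀ {v w d} → Dominating v → IsOrder w d → IsPowerOf w v →
                       ∀ x → pow x d ≡ ε → x ∈ powers w d
  dominating-torsion {v} dom ordw w∈⟨v⟩ x xᵈ≡ε with x Fin.≟ v
  ... | yes refl = cyclic-torsion ordw w∈⟨v⟩ (1 , sym (pow-1 x)) xᵈ≡ε
  ... | no  x≢v with dom x x≢v
  ...   | _ , g , x∈⟨g⟩ , v∈⟨g⟩ = cyclic-torsion ordw (power-of-power w∈⟨v⟩ v∈⟨g⟩) x∈⟨g⟩ xᵈ≡ε

  dominating⇒unique-subgroup : ∀ {v m d} → Dominating v → IsOrder v m → d ∣ m →
                               UniqueSubgroupOfOrder d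
  dominating⇒unique-subgroup {v} dom ordv (divides q refl) =
    unique-subgroup (powers-subgroup ordw) (∣powers∣ ordw) (dominating-torsion dom ordw (q , refl))
    where
    ordw : IsOrder (pow v q) _
    ordw = order-pow q ordv

mainTheorem16 : ∀ {n : ℕ} (_∙_ : Op₂ (Fin n)) (ε : Fin n) (_⁻¹ : Op₁ (Fin n))
    → IsGroup _≡_ _∙_ ε _⁻¹
    → ¬ GroupDefs.Cyclic _∙_ ε _⁻¹
    → (v : Fin n) → v ≢ ε
    → GroupDefs.Dominating _∙_ ε _⁻¹ v
    → (m : ℕ) → GroupDefs.IsOrder _∙_ ε _⁻¹ v m
    → ∃[ p ] (Prime p × p ∣ m × GroupDefs.UniqueSubgroupOfOrder _∙_ ε _⁻¹ p)
-- Since v ≠ e its order m exceeds 1.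
mainTheorem16 _∙_ ε _⁻¹ isGroup _ v v≢ε dominating m ordv =
  let (p , p-prime , p∣m) = prime-divisor (order>1 ordv v≢ε)
  in  p , p-prime , p∣m , dominating⇒unique-subgroup dominating ordv p∣m
  where open FiniteGroup _∙_ ε _⁻¹ isGroup
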